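{- Let $\mathcal{H}\subset\mathcal{O}$ be non-empty, let $\mathfrak{g}_0,\mathfrak{g}_1,\dots$ be a fixed enumeration of the elements of $\bar{\mathcal{H}}$ with $|V_s(\mathfrak{g}_0)|\le|V_s(\mathfrak{g}_1)|\le\cdots$, and for $m\in\mathbb{N}\cup\{0\}$ let $\mathcal{H}(m)=\{\mathfrak{g}_i:0\le i\le\min\{m,|\bar{\mathcal{H}}|-1\}\}$. Then $\mathcal{H}(m)=\overline{\mathcal{H}(m)}$ for every $m\in\mathbb{N}\cup\{0\}$.
   Context: A Hoffman graph $\mathfrak{h}=(H,\mu)$ is a finite simple graph $H$ with labeling $\mu:V(H)\to\{f,s\}$ such that every fat vertex (label $f$) has a slim neighbour (label $s$), and fat vertices are pairwise non-adjacent. $V_s,V_f$ denote slim/fat vertex sets, $N^f_{\mathfrak{h}}(x)$ fat neighbours of $x$. A Hoffman subgraph is an induced subgraph with restricted labeling; isomorphisms preserve labels; families and membership are considered up to isomorphism. Sum: $\mathfrak{h}=\bigoplus_i\mathfrak{h}^i$ (Hoffman subgraphs) means (i) $V(\mathfrak{h})=\bigcup V(\mathfrak{h}^i)$; (ii) $V_s(\mathfrak{h})$ is the disjoint union of the $V_s(\mathfrak{h}^i)$; (iii) $N^f_{\mathfrak{h}^i}(x)=N^f_{\mathfrak{h}}(x)$ for $x\in V_s(\mathfrak{h}^i)$; (iv) for slim $x\in\mathfrak{h}^i$, $y\in\mathfrak{h}^j$, $i\ne j$: $|N^f_{\mathfrak{h}}(x)\cap N^f_{\mathfrak{h}}(y)|\le1$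 with equality iff $x,y$ adjacent. Indecomposable: not a sum of two non-empty Hoffman subgraphs. Fat: every slim vertex has a fat neighbour. $\mathfrak{h}_2$: one slim vertex adjacent to two fat vertices. $\mathcal{O}$: $\mathfrak{h}_2$ together with all indecomposable fat Hoffman graphs with at least two slim vertices and exactly one fat vertex. For $\mathcal{F}\subset\mathcal{O}$, $\bar{\mathcal{F}}=\{\mathfrak{h}_2\}\cup\{\mathfrak{h}\in\mathcal{O}:\mathfrak{h}$ is a Hoffman subgraph of an element of $\mathcal{F}\}$. -}

module Defs where

open import Data.Nat using (ℕ; zero; suc; _+_; _≤_; _<_)
open import Data.Fin using (Fin; zero; suc)
open import Data.Bool using (Bool; true; false; if_then_else_; _∧_)
open import Data.Maybe using (Maybe; just; nothing)
open import Data.Product using (Σ; _×_; _,_; ∃; ∃-syntax)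
open import Data.Sum using (_⊎_)
open import Data.Unit using (⊤)
open import Relation.Nullary using (¬_)
open import Relation.Binary.PropositionalEquality using (_≡_)

data Label : Set where
  fat slim : Label

isFatB : Label → Bool
isFatB fat  = true
isFatB slim = false

isSlimB : Label → Bool
isSlimB fat  = false
isSlimB slim = true

record HoffmanGraph : Set where
  field
    n      : ℕ
    adj    : Fin n → Fin n → Bool
    label  : Fin n → Label
    adj-sym    : ∀ x y → adj x y ≡ adj y x
    adj-irrefl : ∀ x → adj x x ≡ false
    fat-indep  : ∀ x y → label x ≡ fat → label y ≡ fat → adj x y ≡ false
    fat-slimNb : ∀ x → label x ≡ fat →
                 ∃[ y ] (label y ≡ slim × adj x y ≡ true)
open HoffmanGraph public

count : ∀ {k} → (Fin k → Bool) → ℕ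
count {zero}  p = 0
count {suc k} p = (if p zero then 1 else 0) + count (λ i → p (suc i))

slimCount : HoffmanGraph → ℕ
slimCount h = count (λ x → isSlimB (label h x))

fatCount : HoffmanGraph → ℕ
fatCount h = count (λ x → isFatB (label h x))

commonFat : (h : HoffmanGraph) → Fin (n h) → Fin (n h) → ℕ
commonFat h x y = count (λ z → isFatB (label h z) ∧ (adj h x z ∧ adj h y z))

record _≅_ (g h : HoffmanGraph) : Set where
  field
    to       : Fin (n g) → Fin (n h)
    from     : Fin (n h) → Fin (n g)
    from-to  : ∀ x → from (to x) ≡ x
    to-from  : ∀ y → to (from y) ≡ y
    adj-pres : ∀ x y → adj g x y ≡ adj h (to x) (to y)
    lab-pres : ∀ x → label g x ≡ label h (to x)

-- h is (isomorphic to) a Hoffman subgraph of g: a label-preserving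
-- embedding of h onto an induced subgraph of g.  (Since h is itself a
-- Hoffman graph, the image is a Hoffman graph with restricted labeling.)
record _≼_ (h g : HoffmanGraph) : Set where
  field
    emb      : Fin (n h) → Fin (n g)
    emb-inj  : ∀ x y → emb x ≡ emb y → x ≡ y
    adj-pres : ∀ x y → adj h x y ≡ adj g (emb x) (emb y)
    lab-pres : ∀ x → label h x ≡ label g (emb x)

InducesHoffman : (h : HoffmanGraph) → (Fin (n h) → Bool) → Set
InducesHoffman h S = ∀ x → S x ≡ true → label h x ≡ fat →
  ∃[ y ] (S y ≡ true × label h y ≡ slim × adj h x y ≡ true)

NonEmpty : (h : HoffmanGraph) → (Fin (n h) → Bool) → Set
NonEmpty h S = ∃[ x ] (S x ≡ true)

FatNbClosed : (h : HoffmanGraph) → (Fin (n h) → Bool) → Set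
FatNbClosed h S = ∀ x z → S x ≡ true → label h x ≡ slim →
  label h z ≡ fat → adj h x z ≡ true → S z ≡ true

IsSum : (h : HoffmanGraph) → (S T : Fin (n h) → Bool) → Set
IsSum h S T =
  InducesHoffman h S × InducesHoffman h T ×
  (∀ x → S x ≡ true ⊎ T x ≡ true) ×
  (∀ x → label h x ≡ slim → S x ≡ true → T x ≡ false) ×
  FatNbClosed h S × FatNbClosed h T ×
  (∀ x y → S x ≡ true → label h x ≡ slim → T y ≡ true → label h y ≡ slim →
     commonFat h x y ≤ 1 ×
     (commonFat h x y ≡ 1 → adj h x y ≡ true) ×
     (adj h x y ≡ true → commonFat h x y ≡ 1))

Indecomposable : HoffmanGraph → Set
Indecomposable h = ¬ (Σ (Fin (n h) → Bool) λ S → Σ (Fin (n h) → Bool) λ T →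
  NonEmpty h S × NonEmpty h T × IsSum h S T)

IsFatGraph : HoffmanGraph → Set
IsFatGraph h = ∀ x → label h x ≡ slim → ∃[ z ] (label h z ≡ fat × adj h x z ≡ true)

h2-adj : Fin 3 → Fin 3 → Bool
h2-adj zero (suc _) = true
h2-adj (suc _) zero = true
h2-adj _ _ = false

h2-label : Fin 3 → Label
h2-label zero = slim
h2-label (suc _) = fat

h2 : HoffmanGraph
h2 = record
  { n = 3 ; adj = h2-adj ; label = h2-label
  ; adj-sym = sym' ; adj-irrefl = irr ; fat-indep = ind ; fat-slimNb = nb }
  where
  open import Relation.Binary.PropositionalEquality using (refl)
  sym' : ∀ x y → h2-adj x y ≡ h2-adj y x
  sym' zero zero = refl
  sym' zero (suc y) = refl
  sym' (suc x) zero = refl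
  sym' (suc x) (suc y) = refl
  irr : ∀ x → h2-adj x x ≡ false
  irr zero = refl
  irr (suc x) = refl
  ind : ∀ x y → h2-label x ≡ fat → h2-label y ≡ fat → h2-adj x y ≡ false
  ind zero y () q
  ind (suc x) zero p ()
  ind (suc x) (suc y) p q = refl
  nb : ∀ x → h2-label x ≡ fat → ∃[ y ] (h2-label y ≡ slim × h2-adj x y ≡ true)
  nb zero ()
  nb (suc x) p = zero , refl , refl

Family : Set₁
Family = HoffmanGraph → Set

InO : Family
InO h = (h ≅ h2) ⊎
  (Indecomposable h × IsFatGraph h × 2 ≤ slimCount h × fatCount h ≡ 1)

Closure : Family → Family
Closure F h = (h ≅ h2) ⊎ (InO h × ∃[ g ] (F g × h ≼ g))

-- Enumerations g₀, g₁, … of a family (up to isomorphism), possibly infinite.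
-- size = nothing  means infinitely many elements;  just k  means exactly k.

InRange : Maybe ℕ → ℕ → Set
InRange nothing  i = ⊤
InRange (just k) i = i < k

record Enumeration (F : Family) : Set₁ where
  field
    size     : Maybe ℕ
    elem     : ℕ → HoffmanGraph
    sound    : ∀ i → InRange size i → F (elem i)
    complete : ∀ h → F h → ∃[ i ] (InRange size i × elem i ≅ h)
    distinct : ∀ i j → InRange size i → InRange size j →
               elem i ≅ elem j → i ≡ j
    sorted   : ∀ i j → InRange size i → InRange size j → i ≤ j →
               slimCount (elem i) ≤ slimCount (elem j)
open Enumeration public

Initial : ∀ {F} → Enumeration F → ℕ → Family
Initial E m h = ∃[ i ] (i ≤ m × InRange (size E) i × elem E i ≅ h)

-- The graph h₂ is the unique element of 𝒪 with fewer than two slim vertices, so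
-- it is g₀ and lies in every ℋ(m).  Any other element h of the closure of ℋ(m)
-- is a Hoffman subgraph of some g_i with i ≤ m, and hence of an element of ℋ,
-- so h = g_j for some j.  If j > i, the sorting gives |V_s(g_i)| ≤ |V_s(h)|;
-- since h and g_i both have exactly one fat vertex, the embedding h ≼ g_i is
-- onto and g_j ≅ g_i, contradicting distinctness.  Hence j ≤ i ≤ m.
module Submission where

open import Defs
open import Data.Nat using (ℕ; zero; suc; _+_; _≤_; z≤n; s≤s; _≤?_)
open import Data.Nat.Properties
  using ( ≤-refl; ≤-trans; ≤-antisym; ≤-<-trans; <-irrefl; +-mono-≤; +-suc; +-assoc; +-comm
        ; n<1+n; ≰⇒>; <⇒≤ )
open import Data.Fin using (Fin; zero; suc; punchIn; punchOut)
open import Data.Fin.Properties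
  using (suc-injective; punchOut-injective; punchIn-punchOut; any?; pigeonhole; <⇒≢)
  renaming (_≟_ to _≟ᶠ_)
open import Data.Bool using (Bool; true; false; if_then_else_; _∧_)
open import Data.Maybe using (nothing; just)
open import Data.Product using (_×_; _,_; proj₁; proj₂; ∃-syntax)
open import Data.Sum using (inj₁; inj₂)
open import Data.Unit using (tt)
open import Data.Empty using (⊥-elim)
open import Function using (_∘_)
open import Function.Definitions using (Injective)
open import Relation.Nullary using (yes; no; ¬_)
open import Relation.Binary.PropositionalEquality
  using (_≡_; _≢_; refl; sym; trans; cong; cong₂; subst; subst₂)

private
  variable
    a b : ℕ
    F : Family
    g h k : HoffmanGraph

count-punchIn : (i : Fin (suc a)) (q : Fin (suc a) → Bool) →
  count q ≡ (if q i then 1 else 0) + count (q ∘ punchIn i)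
count-punchIn zero q = refl
count-punchIn {suc a} (suc i) q =
  trans (cong (q₀ +_) (count-punchIn i (q ∘ suc))) (+-exchange q₀ (if q (suc i) then 1 else 0) _)
  where
  q₀ = if q zero then 1 else 0
  +-exchange : ∀ x y z → x + (y + z) ≡ y + (x + z)
  +-exchange x y z = trans (sym (+-assoc x y z)) (trans (cong (_+ z) (+-comm x y)) (+-assoc y x z))

-- Removing f 0 from the codomain with punchOut keeps the rest of f injective.
count-≤-injection : (f : Fin a → Fin b) → Injective _≡_ _≡_ f →
  (p : Fin a → Bool) (q : Fin b → Bool) → (∀ x → p x ≡ true → q (f x) ≡ true) →
  count p ≤ count q
count-≤-injection {zero} f inj p q p⇒q = z≤n
count-≤-injection {suc a} {zero} f inj p q p⇒q with f zero
... | ()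
count-≤-injection {suc a} {suc b} f inj p q p⇒q =
  subst (count p ≤_) (sym (count-punchIn (f zero) q))
    (+-mono-≤ head (count-≤-injection f′ f′-injective (p ∘ suc) (q ∘ punchIn (f zero)) tail))
  where
  f0≢f : ∀ x → f zero ≢ f (suc x)
  f0≢f x e with inj e
  ... | ()
  f′ : Fin a → Fin b
  f′ x = punchOut (f0≢f x)
  f′-injective : Injective _≡_ _≡_ f′
  f′-injective {x} {y} e = suc-injective (inj (punchOut-injective (f0≢f x) (f0≢f y) e))
  tail : ∀ x → p (suc x) ≡ true → q (punchIn (f zero) (f′ x)) ≡ true
  tail x px = subst (λ z → q z ≡ true) (sym (punchIn-punchOut (f0≢f x))) (p⇒q (suc x) px)
  head : (if p zero then 1 else 0) ≤ (if q (f zero) then 1 else 0)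
  head with p zero in p0
  ... | false = z≤n
  ... | true rewrite p⇒q zero p0 = ≤-refl

injective⇒surjective : a ≡ b → (f : Fin a → Fin b) → Injective _≡_ _≡_ f →
  ∀ y → ∃[ x ] f x ≡ y
injective⇒surjective {zero} refl f inj ()
injective⇒surjective {suc a} refl f inj y with any? (λ x → f x ≟ᶠ y)
... | yes hit = hit
... | no miss =
  let i , j , i<j , collision = pigeonhole (n<1+n a) (punchOut ∘ f≢y)
  in ⊥-elim (<⇒≢ i<j (inj (punchOut-injective (f≢y i) (f≢y j) collision)))
  where
  f≢y : ∀ x → y ≢ f x
  f≢y x e = miss (x , sym e)

slimCount+fatCount≡n : ∀ {a} (L : Fin a → Label) →
  count (isSlimB ∘ L) + count (isFatB ∘ L) ≡ a
slimCount+fatCount≡n {zero} L = refl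
slimCount+fatCount≡n {suc a} L with L zero
... | slim = cong suc (slimCount+fatCount≡n (L ∘ suc))
... | fat = trans (+-suc _ _) (cong suc (slimCount+fatCount≡n (L ∘ suc)))

≅-refl : g ≅ g
≅-refl = record { to = λ x → x ; from = λ x → x ; from-to = λ _ → refl ; to-from = λ _ → refl
                ; adj-pres = λ _ _ → refl ; lab-pres = λ _ → refl }

≅-sym : g ≅ h → h ≅ g
≅-sym {g} {h} φ = record
  { to = from ; from = to ; from-to = to-from ; to-from = from-to
  ; adj-pres = λ x y →
      trans (cong₂ (adj h) (sym (to-from x)) (sym (to-from y))) (sym (adj-pres (from x) (from y)))
  ; lab-pres = λ x → trans (cong (label h) (sym (to-from x))) (sym (lab-pres (from x))) }
  where open _≅_ φ

≅-trans : g ≅ h → h ≅ k → g ≅ k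
≅-trans φ ψ = record
  { to = ψ.to ∘ φ.to ; from = φ.from ∘ ψ.from
  ; from-to = λ x → trans (cong φ.from (ψ.from-to (φ.to x))) (φ.from-to x)
  ; to-from = λ z → trans (cong ψ.to (φ.to-from (ψ.from z))) (ψ.to-from z)
  ; adj-pres = λ x y → trans (φ.adj-pres x y) (ψ.adj-pres _ _)
  ; lab-pres = λ x → trans (φ.lab-pres x) (ψ.lab-pres _) }
  where module φ = _≅_ φ
        module ψ = _≅_ ψ

≅-to-injective : (φ : g ≅ h) → Injective _≡_ _≡_ (_≅_.to φ)
≅-to-injective φ {x} {y} e = trans (sym (from-to x)) (trans (cong from e) (from-to y))
  where open _≅_ φ

≅⇒≼ : g ≅ h → g ≼ h
≅⇒≼ φ = record
  { emb = to ; emb-inj = λ _ _ → ≅-to-injective φ ; adj-pres = adj-pres ; lab-pres = lab-pres }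
  where open _≅_ φ

≼-refl : g ≼ g
≼-refl = ≅⇒≼ ≅-refl

≼-trans : g ≼ h → h ≼ k → g ≼ k
≼-trans φ ψ = record
  { emb = ψ.emb ∘ φ.emb
  ; emb-inj = λ x y e → φ.emb-inj x y (ψ.emb-inj _ _ e)
  ; adj-pres = λ x y → trans (φ.adj-pres x y) (ψ.adj-pres _ _)
  ; lab-pres = λ x → trans (φ.lab-pres x) (ψ.lab-pres _) }
  where module φ = _≼_ φ
        module ψ = _≼_ ψ

≼⇒slimCount≤ : g ≼ h → slimCount g ≤ slimCount h
≼⇒slimCount≤ φ =
  count-≤-injection emb (emb-inj _ _) _ _ (λ x slim-x → trans (sym (cong isSlimB (lab-pres x))) slim-x)
  where open _≼_ φ

≼⇒≅-of-equal-order : (φ : h ≼ g) → n h ≡ n g → h ≅ g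
≼⇒≅-of-equal-order φ order = record
  { to = emb ; from = proj₁ ∘ onto
  ; from-to = λ x → emb-inj _ _ (proj₂ (onto (emb x)))
  ; to-from = proj₂ ∘ onto
  ; adj-pres = adj-pres ; lab-pres = lab-pres }
  where
  open _≼_ φ
  onto = injective⇒surjective order emb (emb-inj _ _)

module _ {g h : HoffmanGraph} (φ : g ≅ h) where
  open _≅_ φ

  count-≅ : (p : Fin (n g) → Bool) (q : Fin (n h) → Bool) →
    (∀ x → p x ≡ q (to x)) → count p ≡ count q
  count-≅ p q p≡q∘to = ≤-antisym
    (count-≤-injection to (≅-to-injective φ) p q (λ x px → trans (sym (p≡q∘to x)) px))
    (count-≤-injection from (≅-to-injective (≅-sym φ)) q p
      (λ y qy → trans (p≡q∘to (from y)) (trans (cong q (to-from y)) qy)))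

  slimCount-≅ : slimCount g ≡ slimCount h
  slimCount-≅ = count-≅ _ _ (cong isSlimB ∘ lab-pres)

  fatCount-≅ : fatCount g ≡ fatCount h
  fatCount-≅ = count-≅ _ _ (cong isFatB ∘ lab-pres)

  commonFat-≅ : ∀ x y → commonFat g x y ≡ commonFat h (to x) (to y)
  commonFat-≅ x y = count-≅ _ _ λ z →
    cong₂ _∧_ (cong isFatB (lab-pres z)) (cong₂ _∧_ (adj-pres x z) (adj-pres y z))

  label-from : ∀ y → label g (from y) ≡ label h y
  label-from y = trans (lab-pres (from y)) (cong (label h) (to-from y))

  adj-from : ∀ x y → adj g x (from y) ≡ adj h (to x) y
  adj-from x y = trans (adj-pres x (from y)) (cong (adj h (to x)) (to-from y))

  IsFatGraph-≅ : IsFatGraph g → IsFatGraph h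
  IsFatGraph-≅ fat-g y slim-y with fat-g (from y) (trans (label-from y) slim-y)
  ... | z , fat-z , yz = to z , trans (sym (lab-pres z)) fat-z ,
        trans (cong (λ w → adj h w (to z)) (sym (to-from y))) (trans (sym (adj-pres (from y) z)) yz)

  InducesHoffman-pullback : ∀ S → InducesHoffman h S → InducesHoffman g (S ∘ to)
  InducesHoffman-pullback S ind x Sx fat-x with ind (to x) Sx (trans (sym (lab-pres x)) fat-x)
  ... | y , Sy , slim-y , xy = from y , trans (cong S (to-from y)) Sy , trans (label-from y) slim-y ,
                               trans (adj-from x y) xy

  FatNbClosed-pullback : ∀ S → FatNbClosed h S → FatNbClosed g (S ∘ to)
  FatNbClosed-pullback S closed x z Sx slim-x fat-z xz =
    closed (to x) (to z) Sx (trans (sym (lab-pres x)) slim-x) (trans (sym (lab-pres z)) fat-z)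
      (trans (sym (adj-pres x z)) xz)

  IsSum-pullback : ∀ S T → IsSum h S T → IsSum g (S ∘ to) (T ∘ to)
  IsSum-pullback S T (ind-S , ind-T , cover , disjoint , closed-S , closed-T , meet) =
    InducesHoffman-pullback S ind-S , InducesHoffman-pullback T ind-T , cover ∘ to ,
    (λ x slim-x → disjoint (to x) (trans (sym (lab-pres x)) slim-x)) ,
    FatNbClosed-pullback S closed-S , FatNbClosed-pullback T closed-T ,
    λ x y Sx slim-x Ty slim-y → subst₂ MeetCondition (sym (commonFat-≅ x y)) (sym (adj-pres x y))
      (meet (to x) (to y) Sx (trans (sym (lab-pres x)) slim-x) Ty (trans (sym (lab-pres y)) slim-y))
    where
    MeetCondition : ℕ → Bool → Set
    MeetCondition c e = c ≤ 1 × (c ≡ 1 → e ≡ true) × (e ≡ true → c ≡ 1)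

  Indecomposable-≅ : Indecomposable g → Indecomposable h
  Indecomposable-≅ indec-g (S , T , (x , Sx) , (y , Ty) , sum) =
    indec-g (S ∘ to , T ∘ to , (from x , trans (cong S (to-from x)) Sx) ,
             (from y , trans (cong T (to-from y)) Ty) , IsSum-pullback S T sum)

  InO-≅ : InO g → InO h
  InO-≅ (inj₁ g≅h2) = inj₁ (≅-trans (≅-sym φ) g≅h2)
  InO-≅ (inj₂ (indec , fat-g , two-slim , one-fat)) =
    inj₂ (Indecomposable-≅ indec , IsFatGraph-≅ fat-g ,
          subst (2 ≤_) slimCount-≅ two-slim , trans (sym fatCount-≅) one-fat)

2≰1 : ¬ 2 ≤ 1
2≰1 (s≤s ())

≼-h2⇒slimCount≤1 : g ≼ h → h ≅ h2 → slimCount g ≤ 1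
≼-h2⇒slimCount≤1 {g} g≼h h≅h2 = subst (slimCount g ≤_) (slimCount-≅ h≅h2) (≼⇒slimCount≤ g≼h)

InO-of-two-slim : InO h → 2 ≤ slimCount h → fatCount h ≡ 1
InO-of-two-slim (inj₁ h≅h2) two-slim = ⊥-elim (2≰1 (≤-trans two-slim (≼-h2⇒slimCount≤1 ≼-refl h≅h2)))
InO-of-two-slim (inj₂ (_ , _ , _ , one-fat)) _ = one-fat

Closure⇒InO : Closure F h → InO h
Closure⇒InO (inj₁ h≅h2) = inj₁ h≅h2
Closure⇒InO (inj₂ (O-h , _)) = O-h

⊆-Closure : (∀ {h} → F h → InO h) → ∀ {h} → F h → Closure F h
⊆-Closure F⊆O {h} F-h = inj₂ (F⊆O F-h , h , F-h , ≼-refl)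

Closure-≼-closed : Closure F g → InO h → 2 ≤ slimCount h → h ≼ g → Closure F h
Closure-≼-closed (inj₁ g≅h2) _ two-slim h≼g = ⊥-elim (2≰1 (≤-trans two-slim (≼-h2⇒slimCount≤1 h≼g g≅h2)))
Closure-≼-closed (inj₂ (_ , g′ , F-g′ , g≼g′)) O-h _ h≼g =
  inj₂ (O-h , g′ , F-g′ , ≼-trans h≼g g≼g′)

InRange-0 : ∀ s {i} → InRange s i → InRange s 0
InRange-0 nothing _ = tt
InRange-0 (just _) i<k = ≤-<-trans z≤n i<k

module _ {F : Family} (E : Enumeration F) where

  -- If j > i, sorting squeezes |V_s(g_i)| = |V_s(g_j)|, so the embedding is onto.
  ≼⇒index-≤ : ∀ {i j} → InRange (size E) i → InRange (size E) j →
    elem E j ≼ elem E i → fatCount (elem E j) ≡ fatCount (elem E i) → j ≤ i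
  ≼⇒index-≤ {i} {j} ri rj gj≼gi same-fat with j ≤? i
  ... | yes j≤i = j≤i
  ... | no j≰i =
    ⊥-elim (<-irrefl (distinct E i j ri rj (≅-sym (≼⇒≅-of-equal-order gj≼gi same-order))) i<j)
    where
    i<j = ≰⇒> j≰i
    same-slim : slimCount (elem E j) ≡ slimCount (elem E i)
    same-slim = ≤-antisym (≼⇒slimCount≤ gj≼gi) (sorted E i j ri rj (<⇒≤ i<j))
    same-order : n (elem E j) ≡ n (elem E i)
    same-order = trans (sym (slimCount+fatCount≡n (label (elem E j))))
      (trans (cong₂ _+_ same-slim same-fat) (slimCount+fatCount≡n (label (elem E i))))

first-of-Closure≅h2 : (E : Enumeration (Closure F)) → InRange (size E) 0 × elem E 0 ≅ h2
first-of-Closure≅h2 E with complete E h2 (inj₁ ≅-refl)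
... | j , rj , gj≅h2 with Closure⇒InO (sound E 0 (InRange-0 (size E) rj))
... | inj₁ g0≅h2 = InRange-0 (size E) rj , g0≅h2
... | inj₂ (_ , _ , two-slim , _) =
  ⊥-elim (2≰1 (≤-trans two-slim (subst (slimCount (elem E 0) ≤_) (slimCount-≅ gj≅h2)
    (sorted E 0 j (InRange-0 (size E) rj) rj z≤n))))

module _ {H : Family} (E : Enumeration (Closure H)) (m : ℕ) where

  Initial⇒InO : Initial E m h → InO h
  Initial⇒InO (i , _ , ri , gi≅h) = InO-≅ gi≅h (Closure⇒InO (sound E i ri))

  h2∈Initial : h ≅ h2 → Initial E m h
  h2∈Initial h≅h2 =
    let r0 , g0≅h2 = first-of-Closure≅h2 E in 0 , z≤n , r0 , ≅-trans g0≅h2 (≅-sym h≅h2)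

  ≼-elem∈Initial : ∀ {i} → i ≤ m → InRange (size E) i →
    InO h → 2 ≤ slimCount h → h ≼ elem E i → Initial E m h
  ≼-elem∈Initial {h} {i} i≤m ri O-h two-slim h≼gi
    with complete E h (Closure-≼-closed (sound E i ri) O-h two-slim h≼gi)
  ... | j , rj , gj≅h =
    j , ≤-trans (≼⇒index-≤ E ri rj (≼-trans (≅⇒≼ gj≅h) h≼gi) same-fat) i≤m , rj , gj≅h
    where
    same-fat : fatCount (elem E j) ≡ fatCount (elem E i)
    same-fat = trans (fatCount-≅ gj≅h) (trans (InO-of-two-slim O-h two-slim)
      (sym (InO-of-two-slim (Closure⇒InO (sound E i ri)) (≤-trans two-slim (≼⇒slimCount≤ h≼gi)))))

lemma3p14 : (H : Family) → (∀ h → H h → InO h) → ∃[ h ] H h →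
    (E : Enumeration (Closure H)) → (m : ℕ) → ∀ h →
    (Initial E m h → Closure (Initial E m) h) × (Closure (Initial E m) h → Initial E m h)
lemma3p14 H _ _ E m h = ⊆-Closure (Initial⇒InO E m) , closure⇒initial
  where
  closure⇒initial : Closure (Initial E m) h → Initial E m h
  closure⇒initial (inj₁ h≅h2) = h2∈Initial E m h≅h2
  closure⇒initial (inj₂ (inj₁ h≅h2 , _)) = h2∈Initial E m h≅h2
  closure⇒initial (inj₂ (O-h@(inj₂ (_ , _ , two-slim , _)) , g , (i , i≤m , ri , gi≅g) , h≼g)) =
    ≼-elem∈Initial E m i≤m ri O-h two-slim (≼-trans h≼g (≅⇒≼ (≅-sym gi≅g)))
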